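{- Let $n\ge 2$ and $m=n$. Then the metric dimension of the Villarceau grid Type I satisfies $\dim(VG^1_{m,n})>2$.
   Context: For a connected graph $G$ and an ordered set $R=\{r_1,\dots,r_l\}\subseteq V(G)$, the code of a vertex $s$ is $(d(s,r_1),\dots,d(s,r_l))$, where $d$ is the shortest-path distance. $R$ is a resolving set if distinct vertices have distinct codes; $\dim(G)$ is the minimum cardinality of a resolving set. For integers $1\le m\le n$, the Villarceau grid Type I $VG^1_{m,n}$ is the graph with vertex set $\{(2i,2j+1): i\in\{0,\dots,n\},\ j\in\{0,\dots,m-1\}\}\cup\{(2i+1,2j): i\in\{0,\dots,n-1\},\ j\in\{0,\dots,m\}\}$, in which $(i_1,j_1)$ and $(i_2,j_2)$ are adjacent if and only if $|i_1-i_2|=1$ and $|j_1-j_2|=1$. -}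

module Defs where

open import Data.Nat using (ℕ; zero; suc; _+_; _*_; _≤_; _<_; ∣_-_∣)
open import Data.Product using (_×_; _,_; ∃)
open import Data.List using (List)
open import Data.List.Membership.Propositional using (_∈_)
open import Relation.Binary.PropositionalEquality using (_≡_)

Point : Set
Point = ℕ × ℕ

data IsV (m n : ℕ) : Point → Set where
  even-odd : ∀ i j → i ≤ n → j < m → IsV m n (2 * i , suc (2 * j))
  odd-even : ∀ i j → i < n → j ≤ m → IsV m n (suc (2 * i) , 2 * j)

Adj : ℕ → ℕ → Point → Point → Set
Adj m n (x₁ , y₁) (x₂ , y₂) =
  IsV m n (x₁ , y₁) × IsV m n (x₂ , y₂) × ∣ x₁ - x₂ ∣ ≡ 1 × ∣ y₁ - y₂ ∣ ≡ 1

data Walk (m n : ℕ) : Point → Point → ℕ → Set where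
  here : ∀ {u} → IsV m n u → Walk m n u u 0
  step : ∀ {u v w k} → Adj m n u v → Walk m n v w k → Walk m n u w (suc k)

Dist : ℕ → ℕ → Point → Point → ℕ → Set
Dist m n u v d = Walk m n u v d × (∀ k → Walk m n u v k → d ≤ k)

Resolving : ℕ → ℕ → List Point → Set
Resolving m n R =
  ∀ s t → IsV m n s → IsV m n t →
  (∀ r → r ∈ R → ∃ λ d → Dist m n s r d × Dist m n t r d) → s ≡ t

{-# OPTIONS --safe #-}
-- In coordinates, VG¹_{n,n} consists of the points of [0, 2n]² whose two coordinates have
-- different parities, and its edges are the diagonal unit steps.  Its graph distance is the
-- Chebyshev distance max(|Δx|, |Δy|): a walk cannot do better, and thanks to the parity
-- constraint a greedy diagonal step always lowers the Chebyshev distance by one.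
--
-- So it suffices to find, for any two distinct vertices r₁ and r₂, two distinct vertices s and t
-- at equal Chebyshev distance from r₁ and from r₂.  Using the symmetries of the square
-- (transposition, the reflection y ↦ 2n − y, exchanging r₁ and r₂) we may assume that r₂ lies
-- in the cone {|Δy| ≤ Δx} opening rightwards from r₁, and above r₁.  Inside such a cone the
-- distance is the horizontal offset alone, so two vertices of one column lying in the cones
-- of both r₁ and r₂ have the same distances to both.  Such a column exists next to r₁, between
-- r₁ and r₂, or next to r₂, except when r₁ and r₂ lie on a common horizontal boundary (take two
-- vertices of a row at vertical distance 2n − 1 instead) and for the diagonal pair
-- (0, 1), (k + 1, k + 2) (take a pair of points that are mirror images in the line through it).
module Submission where

open import Defs
open import Data.Nat using (ℕ; _≤_; _<_)
open import Data.List using (List; length)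
open import Data.List.Relation.Unary.All using (All)
open import Data.List.Relation.Unary.Unique.Propositional using (Unique)
open import Data.Nat
  using (zero; suc; _+_; _*_; _∸_; _⊔_; _<?_; _≤?_; _≟_; z≤n; s≤s; z<s; ∣_-_∣; parity)
open import Data.Nat.Properties
open import Data.Nat.Tactic.RingSolver using (solve-∀)
open import Data.Parity.Base as ℙ using (Parity; 0ℙ; 1ℙ; _⁻¹)
open import Data.Parity.Properties
  using (⁻¹-selfInverse; ⁻¹-injective; p≢p⁻¹; p+p≡0ℙ; +-homo-+; *-homo-*; suc-homo-⁻¹)
  renaming (+-cancelʳ-≡ to ℙ-+-cancelʳ-≡)
open import Data.List using ([]; _∷_)
open import Data.List.Membership.Propositional using (_∈_)
open import Data.List.Relation.Binary.Subset.Propositional using (_⊆_)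
open import Data.List.Relation.Unary.All as All using ([]; _∷_)
open import Data.List.Relation.Unary.AllPairs using (_∷_)
open import Data.List.Relation.Unary.Any using (here; there)
open import Data.Product using (_×_; _,_; proj₁; proj₂; ∃; ∃₂)
open import Data.Product.Properties using (≡-dec)
open import Data.Sum using (_⊎_; inj₁; inj₂)
open import Function using (_∘_)
open import Relation.Binary.Definitions using (tri<; tri≈; tri>)
open import Relation.Binary.PropositionalEquality
open import Relation.Nullary using (¬_; contradiction; yes; no)

parity-suc : ∀ n → parity (suc n) ≡ parity n ⁻¹
parity-suc n = sym (⁻¹-selfInverse (suc-homo-⁻¹ n))

parity[2*n]≡0ℙ : ∀ n → parity (2 * n) ≡ 0ℙ
parity[2*n]≡0ℙ n = *-homo-* 2 n

parity[1+2*n]≡1ℙ : ∀ n → parity (suc (2 * n)) ≡ 1ℙ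
parity[1+2*n]≡1ℙ n = trans (parity-suc (2 * n)) (cong _⁻¹ (parity[2*n]≡0ℙ n))

parity[2*m]≢parity[1+2*n] : ∀ m n → parity (2 * m) ≢ parity (suc (2 * n))
parity[2*m]≢parity[1+2*n] m n e with trans (sym (parity[2*n]≡0ℙ m)) (trans e (parity[1+2*n]≡1ℙ n))
... | ()

∣m-n∣≡1⇒parity-flips : ∀ m n → ∣ m - n ∣ ≡ 1 → parity n ≡ parity m ⁻¹
∣m-n∣≡1⇒parity-flips zero       (suc zero) _ = refl
∣m-n∣≡1⇒parity-flips (suc zero) zero       _ = refl
∣m-n∣≡1⇒parity-flips (suc m)    (suc n)    e = begin
  parity (suc n)     ≡⟨ parity-suc n ⟩
  parity n ⁻¹        ≡⟨ cong _⁻¹ (∣m-n∣≡1⇒parity-flips m n e) ⟩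
  parity m ⁻¹ ⁻¹     ≡⟨ cong _⁻¹ (parity-suc m) ⟨
  parity (suc m) ⁻¹  ∎
  where open ≡-Reasoning

parity≡⇒∣m-n∣≢1 : ∀ {m n} → parity m ≡ parity n → ∣ m - n ∣ ≢ 1
parity≡⇒∣m-n∣≢1 {m} {n} m≡n Δ = p≢p⁻¹ (parity m) (trans m≡n (∣m-n∣≡1⇒parity-flips m n Δ))

≢⇒≡⁻¹ : ∀ {p q : Parity} → p ≢ q → q ≡ p ⁻¹
≢⇒≡⁻¹ {0ℙ} {0ℙ} p≢q = contradiction refl p≢q
≢⇒≡⁻¹ {0ℙ} {1ℙ} _   = refl
≢⇒≡⁻¹ {1ℙ} {0ℙ} _   = refl
≢⇒≡⁻¹ {1ℙ} {1ℙ} p≢q = contradiction refl p≢q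

≢∧≢⇒≡ : ∀ {p q r : Parity} → p ≢ r → q ≢ r → p ≡ q
≢∧≢⇒≡ p≢r q≢r = trans (≢⇒≡⁻¹ (p≢r ∘ sym)) (sym (≢⇒≡⁻¹ (q≢r ∘ sym)))

p≢q∧p+u≢q+v⇒u≡v : ∀ p q u v → p ≢ q → p ℙ.+ u ≢ q ℙ.+ v → u ≡ v
p≢q∧p+u≢q+v⇒u≡v 0ℙ 0ℙ _  _  p≢q _ = contradiction refl p≢q
p≢q∧p+u≢q+v⇒u≡v 1ℙ 1ℙ _  _  p≢q _ = contradiction refl p≢q
p≢q∧p+u≢q+v⇒u≡v _  _  0ℙ 0ℙ _   _ = refl
p≢q∧p+u≢q+v⇒u≡v _  _  1ℙ 1ℙ _   _ = refl
p≢q∧p+u≢q+v⇒u≡v 0ℙ 1ℙ 0ℙ 1ℙ _   h = contradiction refl h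
p≢q∧p+u≢q+v⇒u≡v 0ℙ 1ℙ 1ℙ 0ℙ _   h = contradiction refl h
p≢q∧p+u≢q+v⇒u≡v 1ℙ 0ℙ 0ℙ 1ℙ _   h = contradiction refl h
p≢q∧p+u≢q+v⇒u≡v 1ℙ 0ℙ 1ℙ 0ℙ _   h = contradiction refl h

offsets-parity : ∀ {a b i j} → parity a ≢ parity b → parity (a + i) ≢ parity (b + j) →
                 parity i ≡ parity j
offsets-parity {a} {b} {i} {j} a≢b a+i≢b+j =
  p≢q∧p+u≢q+v⇒u≡v (parity a) (parity b) (parity i) (parity j) a≢b
    (λ e → a+i≢b+j (trans (+-homo-+ a i) (trans e (sym (+-homo-+ b j)))))

parity[N∸y]≡parity[y] : ∀ {N y} → parity N ≡ 0ℙ → y ≤ N → parity (N ∸ y) ≡ parity y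
parity[N∸y]≡parity[y] {N} {y} N-even y≤N = ℙ-+-cancelʳ-≡ (parity y) _ _ (begin
  parity (N ∸ y) ℙ.+ parity y  ≡⟨ +-homo-+ (N ∸ y) y ⟨
  parity (N ∸ y + y)           ≡⟨ cong parity (m∸n+n≡m y≤N) ⟩
  parity N                     ≡⟨ N-even ⟩
  0ℙ                           ≡⟨ p+p≡0ℙ (parity y) ⟨
  parity y ℙ.+ parity y        ∎)
  where open ≡-Reasoning

record Vertex (N : ℕ) (p : Point) : Set where
  constructor vertex
  field
    x≤N     : proj₁ p ≤ N
    y≤N     : proj₂ p ≤ N
    parity≢ : parity (proj₁ p) ≢ parity (proj₂ p)

data ParityView : ℕ → Set where
  even : ∀ i → ParityView (2 * i)
  odd  : ∀ i → ParityView (suc (2 * i))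

parityView : ∀ n → ParityView n
parityView zero = even 0
parityView (suc n) with parityView n
... | even i = odd i
... | odd i  = subst ParityView (*-suc 2 i) (even (suc i))

i<n⇒1+2*i≤2*n : ∀ {i n} → i < n → suc (2 * i) ≤ 2 * n
i<n⇒1+2*i≤2*n {i} {n} i<n = ≤-trans (n≤1+n _) (subst (_≤ 2 * n) (*-suc 2 i) (*-monoʳ-≤ 2 i<n))

IsV⇒Vertex : ∀ {n p} → IsV n n p → Vertex (2 * n) p
IsV⇒Vertex (even-odd i j i≤n j<n) =
  vertex (*-monoʳ-≤ 2 i≤n) (i<n⇒1+2*i≤2*n j<n) (parity[2*m]≢parity[1+2*n] i j)
IsV⇒Vertex (odd-even i j i<n j≤n) =
  vertex (i<n⇒1+2*i≤2*n i<n) (*-monoʳ-≤ 2 j≤n) (parity[2*m]≢parity[1+2*n] j i ∘ sym)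

Vertex⇒IsV : ∀ {n p} → Vertex (2 * n) p → IsV n n p
Vertex⇒IsV {n} {x , y} (vertex x≤N y≤N x≢y) with parityView x | parityView y
... | even i | odd j  = even-odd i j (*-cancelˡ-≤ 2 x≤N) (*-cancelˡ-< 2 j n (<-≤-trans (n<1+n _) y≤N))
... | odd i  | even j = odd-even i j (*-cancelˡ-< 2 i n (<-≤-trans (n<1+n _) x≤N)) (*-cancelˡ-≤ 2 y≤N)
... | even i | even j = contradiction (trans (parity[2*n]≡0ℙ i) (sym (parity[2*n]≡0ℙ j))) x≢y
... | odd i  | odd j  = contradiction (trans (parity[1+2*n]≡1ℙ i) (sym (parity[1+2*n]≡1ℙ j))) x≢y

vertex⇒0<N : ∀ {N u} → Vertex N u → 0 < N
vertex⇒0<N {zero}  (vertex z≤n z≤n x≢y) = contradiction refl x≢y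
vertex⇒0<N {suc _} _                    = z<s

vertex-step : ∀ {N x y x' y'} → Vertex N (x , y) → x' ≤ N → y' ≤ N →
              ∣ x - x' ∣ ≡ 1 → ∣ y - y' ∣ ≡ 1 → Vertex N (x' , y')
vertex-step {x = x} {y} {x'} {y'} (vertex _ _ x≢y) x'≤N y'≤N Δx Δy = vertex x'≤N y'≤N λ x'≡y' →
  x≢y (⁻¹-injective (begin
    parity x ⁻¹  ≡⟨ ∣m-n∣≡1⇒parity-flips x x' Δx ⟨
    parity x'    ≡⟨ x'≡y' ⟩
    parity y'    ≡⟨ ∣m-n∣≡1⇒parity-flips y y' Δy ⟩
    parity y ⁻¹  ∎))
  where open ≡-Reasoning

cheb : Point → Point → ℕ
cheb (x , y) (p , q) = ∣ x - p ∣ ⊔ ∣ y - q ∣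

cheb-comm : ∀ u v → cheb u v ≡ cheb v u
cheb-comm (x , y) (p , q) = cong₂ _⊔_ (∣-∣-comm x p) (∣-∣-comm y q)

cheb-triangle : ∀ u v w → cheb u w ≤ cheb u v + cheb v w
cheb-triangle (x , y) (p , q) (s , t) =
  ⊔-lub (≤-trans (∣-∣-triangle x p s) (+-mono-≤ (m≤m⊔n ∣ x - p ∣ ∣ y - q ∣) (m≤m⊔n ∣ p - s ∣ ∣ q - t ∣)))
        (≤-trans (∣-∣-triangle y q t) (+-mono-≤ (m≤n⊔m ∣ x - p ∣ ∣ y - q ∣) (m≤n⊔m ∣ p - s ∣ ∣ q - t ∣)))

cheb≡0⇒≡ : ∀ u v → cheb u v ≡ 0 → u ≡ v
cheb≡0⇒≡ (x , y) (p , q) d =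
  cong₂ _,_ (∣m-n∣≡0⇒m≡n (n≤0⇒n≡0 (subst (∣ x - p ∣ ≤_) d (m≤m⊔n _ _))))
            (∣m-n∣≡0⇒m≡n (n≤0⇒n≡0 (subst (∣ y - q ∣ ≤_) d (m≤n⊔m _ _))))

cheb≤walk-length : ∀ {m n u v k} → Walk m n u v k → cheb u v ≤ k
cheb≤walk-length {u = u} (here _) = ≤-reflexive (cong₂ _⊔_ (∣n-n∣≡0 (proj₁ u)) (∣n-n∣≡0 (proj₂ u)))
cheb≤walk-length {u = u} {v} {suc k} (step {v = w} (_ , _ , Δx , Δy) walk) = begin
  cheb u v             ≤⟨ cheb-triangle u w v ⟩
  cheb u w + cheb w v  ≤⟨ +-mono-≤ (≤-reflexive (cong₂ _⊔_ Δx Δy)) (cheb≤walk-length walk) ⟩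
  suc k                ∎
  where open ≤-Reasoning

∣n-1+n∣≡1 : ∀ n → ∣ n - suc n ∣ ≡ 1
∣n-1+n∣≡1 zero    = refl
∣n-1+n∣≡1 (suc n) = ∣n-1+n∣≡1 n

∣1+n-n∣≡1 : ∀ n → ∣ suc n - n ∣ ≡ 1
∣1+n-n∣≡1 n = trans (∣-∣-comm (suc n) n) (∣n-1+n∣≡1 n)

m<n⇒1+∣1+m-n∣≡∣m-n∣ : ∀ {m n} → m < n → suc ∣ suc m - n ∣ ≡ ∣ m - n ∣
m<n⇒1+∣1+m-n∣≡∣m-n∣ {zero}  {suc n} _         = refl
m<n⇒1+∣1+m-n∣≡∣m-n∣ {suc m} {suc n} (s≤s m<n) = m<n⇒1+∣1+m-n∣≡∣m-n∣ m<n

n≤m⇒1+∣m-n∣≡∣1+m-n∣ : ∀ {m n} → n ≤ m → suc ∣ m - n ∣ ≡ ∣ suc m - n ∣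
n≤m⇒1+∣m-n∣≡∣1+m-n∣ {m}     {zero}  _         = cong suc (∣-∣-identityʳ m)
n≤m⇒1+∣m-n∣≡∣1+m-n∣ {suc m} {suc n} (s≤s n≤m) = n≤m⇒1+∣m-n∣≡∣1+m-n∣ n≤m

approach : ∀ {N} x t → x ≤ N → t ≤ N → 0 < N →
           ∃ λ x' → x' ≤ N × ∣ x - x' ∣ ≡ 1 × (suc ∣ x' - t ∣ ≡ ∣ x - t ∣ ⊎ x ≡ t)
approach x t x≤N t≤N 0<N with <-cmp x t
... | tri< x<t _ _ = suc x , <-≤-trans x<t t≤N , ∣n-1+n∣≡1 x , inj₁ (m<n⇒1+∣1+m-n∣≡∣m-n∣ x<t)
approach (suc x) t x≤N t≤N 0<N | tri> _ _ (s≤s t≤x) =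
  x , ≤-trans (n≤1+n x) x≤N , ∣1+n-n∣≡1 x , inj₁ (n≤m⇒1+∣m-n∣≡∣1+m-n∣ t≤x)
approach {N} x t x≤N t≤N 0<N | tri≈ _ x≡t _ with x <? N
... | yes x<N = suc x , x<N , ∣n-1+n∣≡1 x , inj₂ x≡t
approach zero    t x≤N t≤N 0<N | tri≈ _ x≡t _ | no x≮N = contradiction 0<N x≮N
approach (suc x) t x≤N t≤N 0<N | tri≈ _ x≡t _ | no x≮N =
  x , ≤-trans (n≤1+n x) x≤N , ∣1+n-n∣≡1 x , inj₂ x≡t

-- A coordinate that already agrees moves away by one; by parity the other offset is then at
-- least 2, so the maximum still drops by one.
approach-decreases-cheb : ∀ {x y p q x' y' k} → parity x ≢ parity y → parity p ≢ parity q →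
  ∣ x - x' ∣ ≡ 1 → ∣ y - y' ∣ ≡ 1 →
  (suc ∣ x' - p ∣ ≡ ∣ x - p ∣ ⊎ x ≡ p) → (suc ∣ y' - q ∣ ≡ ∣ y - q ∣ ⊎ y ≡ q) →
  ∣ x - p ∣ ⊔ ∣ y - q ∣ ≡ suc k → ∣ x' - p ∣ ⊔ ∣ y' - q ∣ ≡ k
approach-decreases-cheb _ _ _ _ (inj₁ cx) (inj₁ cy) d = suc-injective (trans (cong₂ _⊔_ cx cy) d)
approach-decreases-cheb {x} {y} {q = q} {x'} {k = k} x≢y x≢q Δx _ (inj₂ refl) (inj₁ cy) d =
  trans (cong₂ _⊔_ (trans (∣-∣-comm x' x) Δx) (suc-injective (trans cy Δy≡1+k))) (m≤n⇒m⊔n≡n 1≤k)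
  where
  Δy≡1+k : ∣ y - q ∣ ≡ suc k
  Δy≡1+k = trans (cong (_⊔ ∣ y - q ∣) (sym (∣n-n∣≡0 x))) d
  1≤k : 1 ≤ k
  1≤k = n≢0⇒n>0 λ { refl → parity≡⇒∣m-n∣≢1 {y} {q} (≢∧≢⇒≡ (x≢y ∘ sym) (x≢q ∘ sym)) Δy≡1+k }
approach-decreases-cheb {x} {y} {p} {y' = y'} {k} x≢y p≢y _ Δy (inj₁ cx) (inj₂ refl) d =
  trans (cong₂ _⊔_ (suc-injective (trans cx Δx≡1+k)) (trans (∣-∣-comm y' y) Δy)) (m≥n⇒m⊔n≡m 1≤k)
  where
  Δx≡1+k : ∣ x - p ∣ ≡ suc k
  Δx≡1+k = trans (sym (⊔-identityʳ ∣ x - p ∣)) (trans (cong (∣ x - p ∣ ⊔_) (sym (∣n-n∣≡0 y))) d)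
  1≤k : 1 ≤ k
  1≤k = n≢0⇒n>0 λ { refl → parity≡⇒∣m-n∣≢1 {x} {p} (≢∧≢⇒≡ x≢y p≢y) Δx≡1+k }
approach-decreases-cheb {x} {y} _ _ _ _ (inj₂ refl) (inj₂ refl) d
  with trans (sym (cong₂ _⊔_ (∣n-n∣≡0 x) (∣n-n∣≡0 y))) d
... | ()

step-towards : ∀ {N k u v} → Vertex N u → Vertex N v → cheb u v ≡ suc k →
  ∃ λ w → Vertex N w × ∣ proj₁ u - proj₁ w ∣ ≡ 1 × ∣ proj₂ u - proj₂ w ∣ ≡ 1 × cheb w v ≡ k
step-towards {u = x , y} {p , q} vu@(vertex x≤N y≤N x≢y) (vertex p≤N q≤N p≢q) d
  with approach x p x≤N p≤N (vertex⇒0<N vu) | approach y q y≤N q≤N (vertex⇒0<N vu)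
... | x' , x'≤N , Δx , cx | y' , y'≤N , Δy , cy =
  (x' , y') , vertex-step vu x'≤N y'≤N Δx Δy , Δx , Δy , approach-decreases-cheb x≢y p≢q Δx Δy cx cy d

walk-of-length-cheb : ∀ {n} k {u v} → Vertex (2 * n) u → Vertex (2 * n) v → cheb u v ≡ k → Walk n n u v k
walk-of-length-cheb {n} zero {u} {v} vu _ d =
  subst (λ w → Walk n n u w 0) (cheb≡0⇒≡ u v d) (here (Vertex⇒IsV vu))
walk-of-length-cheb (suc k) vu vv d with step-towards vu vv d
... | w , vw , Δx , Δy , d' = step (Vertex⇒IsV vu , Vertex⇒IsV vw , Δx , Δy) (walk-of-length-cheb k vw vv d')

cheb-is-distance : ∀ {n u v} → Vertex (2 * n) u → Vertex (2 * n) v → Dist n n u v (cheb u v)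
cheb-is-distance vu vv = walk-of-length-cheb _ vu vv refl , λ _ → cheb≤walk-length

record Unresolved (N : ℕ) (r₁ r₂ : Point) : Set where
  constructor unresolved
  field
    s t          : Point
    s-vertex     : Vertex N s
    t-vertex     : Vertex N t
    s≢t          : s ≢ t
    equidistant₁ : cheb s r₁ ≡ cheb t r₁
    equidistant₂ : cheb s r₂ ≡ cheb t r₂

unresolved-swap : ∀ {N r₁ r₂} → Unresolved N r₂ r₁ → Unresolved N r₁ r₂
unresolved-swap (unresolved s t vs vt s≢t e₂ e₁) = unresolved s t vs vt s≢t e₁ e₂

record GridSymmetry (N : ℕ) : Set where
  field
    act        : Point → Point
    vertex-act : ∀ {p} → Vertex N p → Vertex N (act p)
    involutive : ∀ {p} → Vertex N p → act (act p) ≡ p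
    isometry   : ∀ {p q} → Vertex N p → Vertex N q → cheb (act p) (act q) ≡ cheb p q

  act-injective : ∀ {p q} → Vertex N p → Vertex N q → act p ≡ act q → p ≡ q
  act-injective vp vq e = trans (sym (involutive vp)) (trans (cong act e) (involutive vq))

  cheb-act : ∀ {p r} → Vertex N p → Vertex N r → cheb (act p) r ≡ cheb p (act r)
  cheb-act vp vr = trans (cong (cheb (act _)) (sym (involutive vr))) (isometry vp (vertex-act vr))

  unresolved-transport : ∀ {r₁ r₂} → Vertex N r₁ → Vertex N r₂ →
                         Unresolved N (act r₁) (act r₂) → Unresolved N r₁ r₂
  unresolved-transport v₁ v₂ (unresolved s t vs vt s≢t e₁ e₂) =
    unresolved (act s) (act t) (vertex-act vs) (vertex-act vt) (s≢t ∘ act-injective vs vt)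
      (trans (cheb-act vs v₁) (trans e₁ (sym (cheb-act vt v₁))))
      (trans (cheb-act vs v₂) (trans e₂ (sym (cheb-act vt v₂))))

open GridSymmetry using (vertex-act; act-injective; unresolved-transport)

transpose : ∀ {N} → GridSymmetry N
transpose = record
  { act        = λ (x , y) → (y , x)
  ; vertex-act = λ (vertex x≤N y≤N x≢y) → vertex y≤N x≤N (x≢y ∘ sym)
  ; involutive = λ _ → refl
  ; isometry   = λ {(x , y)} {(p , q)} _ _ → ⊔-comm ∣ y - q ∣ ∣ x - p ∣
  }

∣N∸m-N∸n∣≡∣m-n∣ : ∀ N {m n} → m ≤ N → n ≤ N → ∣ N ∸ m - N ∸ n ∣ ≡ ∣ m - n ∣
∣N∸m-N∸n∣≡∣m-n∣ N {m} {n} m≤N n≤N = begin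
  ∣ N ∸ m - N ∸ n ∣                      ≡⟨ ∣m+n-m+o∣≡∣n-o∣ (m + n) (N ∸ m) (N ∸ n) ⟨
  ∣ m + n + (N ∸ m) - m + n + (N ∸ n) ∣  ≡⟨ cong₂ ∣_-_∣ shift-m shift-n ⟩
  ∣ N + n - N + m ∣                      ≡⟨ ∣m+n-m+o∣≡∣n-o∣ N n m ⟩
  ∣ n - m ∣                              ≡⟨ ∣-∣-comm n m ⟩
  ∣ m - n ∣                              ∎
  where
  open ≡-Reasoning
  shift-m : m + n + (N ∸ m) ≡ N + n
  shift-m = begin
    m + n + (N ∸ m)    ≡⟨ cong (_+ (N ∸ m)) (+-comm m n) ⟩
    n + m + (N ∸ m)    ≡⟨ +-assoc n m (N ∸ m) ⟩
    n + (m + (N ∸ m))  ≡⟨ cong (n +_) (m+[n∸m]≡n m≤N) ⟩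
    n + N              ≡⟨ +-comm n N ⟩
    N + n              ∎
  shift-n : m + n + (N ∸ n) ≡ N + m
  shift-n = begin
    m + n + (N ∸ n)    ≡⟨ +-assoc m n (N ∸ n) ⟩
    m + (n + (N ∸ n))  ≡⟨ cong (m +_) (m+[n∸m]≡n n≤N) ⟩
    m + N              ≡⟨ +-comm m N ⟩
    N + m              ∎

reflect : ∀ {N} → parity N ≡ 0ℙ → GridSymmetry N
reflect {N} N-even = record
  { act        = λ (x , y) → (x , N ∸ y)
  ; vertex-act = λ {(x , y)} (vertex x≤N y≤N x≢y) →
                   vertex x≤N (m∸n≤m N y) (λ e → x≢y (trans e (parity[N∸y]≡parity[y] N-even y≤N)))
  ; involutive = λ {(x , y)} v → cong (x ,_) (m∸[m∸n]≡n (Vertex.y≤N v))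
  ; isometry   = λ {(x , y)} {(p , q)} vp vq →
                   cong (∣ x - p ∣ ⊔_) (∣N∸m-N∸n∣≡∣m-n∣ N (Vertex.y≤N vp) (Vertex.y≤N vq))
  }

-- v lies in the cone opening rightwards from u, in which the horizontal offset dominates.
infix 4 _◁_
record _◁_ (u v : Point) : Set where
  constructor cone
  field
    gap : ∣ proj₂ u - proj₂ v ∣ + proj₁ u ≤ proj₁ v

◁-trans : ∀ {u v w} → u ◁ v → v ◁ w → u ◁ w
◁-trans {x , y} {p , q} {s , t} (cone u◁v) (cone v◁w) = cone (begin
  ∣ y - t ∣ + x                ≤⟨ +-monoˡ-≤ x (∣-∣-triangle y q t) ⟩
  ∣ y - q ∣ + ∣ q - t ∣ + x    ≡⟨ cong (_+ x) (+-comm ∣ y - q ∣ ∣ q - t ∣) ⟩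
  ∣ q - t ∣ + ∣ y - q ∣ + x    ≡⟨ +-assoc ∣ q - t ∣ ∣ y - q ∣ x ⟩
  ∣ q - t ∣ + (∣ y - q ∣ + x)  ≤⟨ +-monoʳ-≤ ∣ q - t ∣ u◁v ⟩
  ∣ q - t ∣ + p                ≤⟨ v◁w ⟩
  s                            ∎)
  where open ≤-Reasoning

◁-↗ : ∀ x y → (x , y) ◁ (suc x , suc y)
◁-↗ x y = cone (≤-reflexive (cong (_+ x) (∣n-1+n∣≡1 y)))

◁-↘ : ∀ x y → (x , suc y) ◁ (suc x , y)
◁-↘ x y = cone (≤-reflexive (cong (_+ x) (∣1+n-n∣≡1 y)))

◁⇒≤ : ∀ {u v} → u ◁ v → proj₁ u ≤ proj₁ v
◁⇒≤ {_ , y} {_ , q} (cone gap) = m+n≤o⇒n≤o ∣ y - q ∣ gap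

◁-offset : ∀ {a b i f E} → i ≤ f → (i + a , b) ◁ (a + (f + E) , b + E)
◁-offset {a} {b} {i} {f} {E} i≤f = cone (begin
  ∣ b - b + E ∣ + (i + a)  ≡⟨ cong (_+ (i + a)) (∣m-m+n∣≡n b E) ⟩
  E + (i + a)              ≡⟨ +-assoc E i a ⟨
  E + i + a                ≤⟨ +-monoˡ-≤ a (+-monoʳ-≤ E i≤f) ⟩
  E + f + a                ≡⟨ cong (_+ a) (+-comm E f) ⟩
  f + E + a                ≡⟨ +-comm (f + E) a ⟩
  a + (f + E)              ∎)
  where open ≤-Reasoning

dominant⇒◁ : ∀ {x y p q} → x ≤ p → ∣ y - q ∣ ≤ ∣ x - p ∣ → (x , y) ◁ (p , q)
dominant⇒◁ {x} {y} {p} {q} x≤p dom = cone (begin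
  ∣ y - q ∣ + x  ≤⟨ +-monoˡ-≤ x (≤-trans dom (≤-reflexive (m≤n⇒∣m-n∣≡n∸m x≤p))) ⟩
  p ∸ x + x      ≡⟨ m∸n+n≡m x≤p ⟩
  p              ∎)
  where open ≤-Reasoning

◁-reflect : ∀ {N x y p q} → y ≤ N → q ≤ N → (x , y) ◁ (p , q) → (x , N ∸ y) ◁ (p , N ∸ q)
◁-reflect {N} {x} {y} {p} {q} y≤N q≤N (cone gap) =
  cone (subst (λ d → d + x ≤ p) (sym (∣N∸m-N∸n∣≡∣m-n∣ N y≤N q≤N)) gap)

cheb-◁ : ∀ {u v} → u ◁ v → cheb u v ≡ proj₁ v ∸ proj₁ u
cheb-◁ {x , y} {p , q} u◁v@(cone gap) = begin
  ∣ x - p ∣ ⊔ ∣ y - q ∣  ≡⟨ cong (_⊔ ∣ y - q ∣) (m≤n⇒∣m-n∣≡n∸m (◁⇒≤ u◁v)) ⟩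
  (p ∸ x) ⊔ ∣ y - q ∣    ≡⟨ m≥n⇒m⊔n≡m (m+n≤o⇒m≤o∸n ∣ y - q ∣ gap) ⟩
  p ∸ x                  ∎
  where open ≡-Reasoning

column-◁ : ∀ {x y y' r} → (x , y) ◁ r → (x , y') ◁ r → cheb (x , y) r ≡ cheb (x , y') r
column-◁ s◁r t◁r = trans (cheb-◁ s◁r) (sym (cheb-◁ t◁r))

◁-column : ∀ {x y y' r} → r ◁ (x , y) → r ◁ (x , y') → cheb (x , y) r ≡ cheb (x , y') r
◁-column {x} {y} {y'} {r} r◁s r◁t =
  trans (cheb-comm (x , y) r) (trans (cheb-◁ r◁s) (sym (trans (cheb-comm (x , y') r) (cheb-◁ r◁t))))

[x,y]≢[x,2+y] : ∀ {x y : ℕ} → (x , y) ≢ (x , 2 + y)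
[x,y]≢[x,2+y] {y = y} e = <⇒≢ (m<n+m y z<s) (cong proj₂ e)

unresolved-left-of : ∀ {N a b r} → Vertex N (suc a , suc b) → 2 + b ≤ N → (suc a , suc b) ◁ r →
                     Unresolved N (suc a , suc b) r
unresolved-left-of {N} {a} {b} v 2+b≤N r₁◁r =
  unresolved (a , b) (a , 2 + b) vs (vertex (Vertex.x≤N vs) 2+b≤N (Vertex.parity≢ vs)) [x,y]≢[x,2+y]
    (column-◁ (◁-↗ a b) (◁-↘ a (suc b)))
    (column-◁ (◁-trans (◁-↗ a b) r₁◁r) (◁-trans (◁-↘ a (suc b)) r₁◁r))
  where
  vs : Vertex N (a , b)
  vs = vertex-step v (≤-trans (n≤1+n a) (Vertex.x≤N v)) (≤-trans (n≤1+n b) (Vertex.y≤N v))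
                     (∣1+n-n∣≡1 a) (∣1+n-n∣≡1 b)

unresolved-between : ∀ {N a b r} → Vertex N (a , suc b) → 2 + b ≤ N → Vertex N r → (2 + a , suc b) ◁ r →
                     Unresolved N (a , suc b) r
unresolved-between {N} {a} {b} v 2+b≤N vr m◁r =
  unresolved (suc a , b) (suc a , 2 + b) vs (vertex (Vertex.x≤N vs) 2+b≤N (Vertex.parity≢ vs)) [x,y]≢[x,2+y]
    (◁-column (◁-↘ a b) (◁-↗ a (suc b)))
    (column-◁ (◁-trans (◁-↗ (suc a) b) m◁r) (◁-trans (◁-↘ (suc a) (suc b)) m◁r))
  where
  vs : Vertex N (suc a , b)
  vs = vertex-step v (≤-trans (n≤1+n (suc a)) (≤-trans (◁⇒≤ m◁r) (Vertex.x≤N vr)))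
                     (≤-trans (n≤1+n b) (Vertex.y≤N v)) (∣n-1+n∣≡1 a) (∣1+n-n∣≡1 b)

unresolved-above-bottom : ∀ {N a p q} → Vertex N (a , 0) → Vertex N (p , suc q) → (2 + a , 0) ◁ (p , suc q) →
                          Unresolved N (a , 0) (p , suc q)
unresolved-above-bottom {a = a} {p} {q} v vr s◁r =
  unresolved (2 + a , 0) (2 + a , 2) (vertex 2+a≤N z≤n (Vertex.parity≢ v))
    (vertex 2+a≤N (≤-trans (m≤m+n 2 a) 2+a≤N) (Vertex.parity≢ v)) (λ ())
    (◁-column r◁s r◁t) (column-◁ s◁r t◁r)
  where
  2+a≤N = ≤-trans (◁⇒≤ s◁r) (Vertex.x≤N vr)
  r◁s : (a , 0) ◁ (2 + a , 0)
  r◁s = cone (m≤n+m a 2)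
  r◁t : (a , 0) ◁ (2 + a , 2)
  r◁t = cone ≤-refl
  t◁r : (2 + a , 2) ◁ (p , suc q)
  t◁r = cone (≤-trans (+-monoˡ-≤ (2 + a) (≤-trans (∣m-n∣≤m⊔n 1 q) (⊔-lub (s≤s z≤n) (n≤1+n q))))
                      (_◁_.gap s◁r))

unresolved-right-of : ∀ {N a b r} → Vertex N (a , 2 + b) → 2 + a ≤ N → r ◁ (a , 2 + b) →
                      Unresolved N r (a , 2 + b)
unresolved-right-of {a = a} {b} v 2+a≤N r◁r₂ =
  unresolved (2 + a , 2 + b) (2 + a , b) (vertex 2+a≤N (Vertex.y≤N v) (Vertex.parity≢ v))
    (vertex 2+a≤N (≤-trans (m≤n+m b 2) (Vertex.y≤N v)) (Vertex.parity≢ v)) ([x,y]≢[x,2+y] ∘ sym)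
    (◁-column (◁-trans r◁r₂ r₂◁s) (◁-trans r◁r₂ r₂◁t)) (◁-column r₂◁s r₂◁t)
  where
  r₂◁s : (a , 2 + b) ◁ (2 + a , 2 + b)
  r₂◁s = ◁-trans (◁-↘ a (suc b)) (◁-↗ (suc a) (suc b))
  r₂◁t : (a , 2 + b) ◁ (2 + a , b)
  r₂◁t = ◁-trans (◁-↘ a (suc b)) (◁-↘ (suc a) b)

-- (0 , 3) and (2 , 1) are mirror images in the line y = x + 1, which contains both points.
unresolved-mirror : ∀ {N k} → 3 ≤ N → Unresolved N (0 , 1) (suc k , 2 + k)
unresolved-mirror {k = k} 3≤N =
  unresolved (0 , 3) (2 , 1) (vertex z≤n 3≤N (λ ()))
    (vertex (≤-trans (n≤1+n 2) 3≤N) (≤-trans (s≤s z≤n) 3≤N) (λ ())) (λ ())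
    refl (⊔-comm (suc k) ∣ 1 - k ∣)

row-equidistant : ∀ {M a y c} → 2 ≤ M → ∣ c - y ∣ ≡ M → a ≤ M → cheb (0 , c) (a , y) ≡ cheb (2 , c) (a , y)
row-equidistant {a = a} 2≤M c-y a≤M rewrite c-y =
  trans (m≤n⇒m⊔n≡n a≤M) (sym (m≤n⇒m⊔n≡n (≤-trans (∣m-n∣≤m⊔n 2 a) (⊔-lub 2≤M a≤M))))

unresolved-boundary-row : ∀ {M a a' y c} → 2 ≤ M → Vertex (suc M) (0 , c) → ∣ c - y ∣ ≡ M →
                          a ≤ M → a' ≤ M → Unresolved (suc M) (a , y) (a' , y)
unresolved-boundary-row {M} {a} {a'} {y} {c} 2≤M v c-y a≤M a'≤M =
  unresolved (0 , c) (2 , c) v (vertex (≤-trans 2≤M (n≤1+n M)) (Vertex.y≤N v) (Vertex.parity≢ v)) (λ ())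
    (row-equidistant {a = a} {y} {c} 2≤M c-y a≤M) (row-equidistant {a = a'} {y} {c} 2≤M c-y a'≤M)

x≤M-on-even-row : ∀ {M a y} → parity (suc M) ≡ 0ℙ → parity y ≡ 0ℙ → Vertex (suc M) (a , y) → a ≤ M
x≤M-on-even-row N-even y-even v = ≤-pred (≤∧≢⇒< (Vertex.x≤N v) λ a≡N →
  Vertex.parity≢ v (trans (cong parity a≡N) (trans N-even (sym y-even))))

same-row-gap : ∀ {N a a' y} → Vertex N (a , y) → Vertex N (a' , y) → a < a' → 2 + a ≤ a'
same-row-gap {a = a} v v' a<a' = ≤∧≢⇒< a<a' λ { refl →
  p≢p⁻¹ (parity a) (sym (trans (sym (parity-suc a)) (≢∧≢⇒≡ (Vertex.parity≢ v') (Vertex.parity≢ v)))) }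

unresolved-same-row : ∀ {N a a' y} → parity N ≡ 0ℙ → 3 ≤ N → Vertex N (a , y) → Vertex N (a' , y) → a < a' →
                      Unresolved N (a , y) (a' , y)
unresolved-same-row {suc M} {y = zero} N-even (s≤s 2≤M) v v' _ =
  unresolved-boundary-row {c = M} 2≤M (vertex z≤n (n≤1+n M) M-odd) (∣-∣-identityʳ M)
    (x≤M-on-even-row N-even refl v) (x≤M-on-even-row N-even refl v')
  where
  M-odd : parity 0 ≢ parity M
  M-odd e with trans (sym N-even) (trans (parity-suc M) (cong _⁻¹ (sym e)))
  ... | ()
unresolved-same-row {N} {a} {a'} {suc y} N-even 3≤N v v' a<a' with 2 + y ≤? N
... | yes 2+y≤N = unresolved-between v 2+y≤N v'
                    (cone (subst (λ d → d + (2 + a) ≤ a') (sym (∣n-n∣≡0 y)) (same-row-gap v v' a<a')))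
... | no 2+y≰N with ≤-antisym (Vertex.y≤N v) (≤-pred (≰⇒> 2+y≰N))
...   | refl = unresolved-boundary-row {c = 1} (≤-pred 3≤N) (vertex z≤n (s≤s z≤n) (λ ())) refl
                 (x≤M-on-even-row N-even N-even v) (x≤M-on-even-row N-even N-even v')

unresolved-diagonal-edge : ∀ {N b k} → 3 ≤ N → Vertex N (0 , b) → Vertex N (suc k , b + suc k) →
                           Unresolved N (0 , b) (suc k , b + suc k)
unresolved-diagonal-edge {b = zero}        _   v₁ _  = contradiction refl (Vertex.parity≢ v₁)
unresolved-diagonal-edge {b = suc zero}    3≤N _  _  = unresolved-mirror 3≤N
unresolved-diagonal-edge {b = suc (suc c)} {k} _ _ v₂ =
  unresolved-right-of v₂ (≤-trans (+-monoˡ-≤ (suc k) (m≤m+n 2 c)) (Vertex.y≤N v₂)) (◁-offset {f = 0} z≤n)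

unresolved-diagonal : ∀ {N a b k} → 3 ≤ N → Vertex N (a , b) → Vertex N (a + suc k , b + suc k) →
                      Unresolved N (a , b) (a + suc k , b + suc k)
unresolved-diagonal {a = zero} 3≤N v₁ v₂ = unresolved-diagonal-edge 3≤N v₁ v₂
unresolved-diagonal {a = suc _} {zero} 3≤N v₁ v₂ =
  unresolved-transport transpose v₁ v₂
    (unresolved-diagonal-edge 3≤N (vertex-act transpose v₁) (vertex-act transpose v₂))
unresolved-diagonal {a = suc _} {suc b} _ v₁ v₂ =
  unresolved-left-of v₁ (≤-trans (s≤s (m<m+n b z<s)) (Vertex.y≤N v₂)) (◁-offset {f = 0} z≤n)

unresolved-shallow : ∀ {N a b g e} → Vertex N (a , b) → Vertex N (a + (2 + g + suc e) , b + suc e) →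
                     Unresolved N (a , b) (a + (2 + g + suc e) , b + suc e)
unresolved-shallow {b = zero} v₁ v₂ = unresolved-above-bottom v₁ v₂ (◁-offset (s≤s (s≤s z≤n)))
unresolved-shallow {b = suc b} v₁ v₂ =
  unresolved-between v₁ (≤-trans (s≤s (m<m+n b z<s)) (Vertex.y≤N v₂)) v₂ (◁-offset (s≤s (s≤s z≤n)))

unresolved-rising : ∀ {N a b f e} → 3 ≤ N → Vertex N (a , b) → Vertex N (a + (f + suc e) , b + suc e) →
                    Unresolved N (a , b) (a + (f + suc e) , b + suc e)
unresolved-rising {f = 0} 3≤N v₁ v₂ = unresolved-diagonal 3≤N v₁ v₂
unresolved-rising {a = a} {b} {f = 1} {e} _ v₁ v₂ =
  contradiction (trans (offsets-parity {a} {b} {2 + e} {suc e} (Vertex.parity≢ v₁) (Vertex.parity≢ v₂))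
                       (parity-suc e))
                (p≢p⁻¹ (parity e))
unresolved-rising {f = suc (suc _)} _ v₁ v₂ = unresolved-shallow v₁ v₂

∣m-1+m+n∣≡1+n : ∀ m n → ∣ m - suc (m + n) ∣ ≡ suc n
∣m-1+m+n∣≡1+n m n = trans (cong (∣ m -_∣) (sym (+-suc m n))) (∣m-m+n∣≡n m (suc n))

rising-offsets : ∀ {a b a' b'} → (a , b) ◁ (a' , b') → b < b' →
                 ∃₂ λ f e → a' ≡ a + (f + suc e) × b' ≡ b + suc e
rising-offsets {a} {b} {a'} (cone gap) b<b' with m≤n⇒∃[o]m+o≡n b<b'
... | e , refl with m≤n⇒∃[o]m+o≡n (subst (λ d → d + a ≤ a') (∣m-1+m+n∣≡1+n b e) gap)
...   | f , refl = f , e , rearrange a e f , sym (+-suc b e)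
  where
  rearrange : ∀ a e f → suc e + a + f ≡ a + (f + suc e)
  rearrange = solve-∀

unresolved-upward : ∀ {N a b a' b'} → parity N ≡ 0ℙ → 3 ≤ N → Vertex N (a , b) → Vertex N (a' , b') →
                    (a , b) ≢ (a' , b') → (a , b) ◁ (a' , b') → b ≤ b' → Unresolved N (a , b) (a' , b')
unresolved-upward {b = b} N-even 3≤N v₁ v₂ r₁≢r₂ r₁◁r₂ b≤b' with m≤n⇒m<n∨m≡n b≤b'
... | inj₂ refl = unresolved-same-row N-even 3≤N v₁ v₂ (≤∧≢⇒< (◁⇒≤ r₁◁r₂) (r₁≢r₂ ∘ cong (_, b)))
... | inj₁ b<b' with rising-offsets r₁◁r₂ b<b'
...   | f , e , refl , refl = unresolved-rising 3≤N v₁ v₂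

unresolved-rightward : ∀ {N r₁ r₂} → parity N ≡ 0ℙ → 3 ≤ N → Vertex N r₁ → Vertex N r₂ → r₁ ≢ r₂ →
                       r₁ ◁ r₂ → Unresolved N r₁ r₂
unresolved-rightward {N} {_ , b} {_ , b'} N-even 3≤N v₁ v₂ r₁≢r₂ r₁◁r₂ with b ≤? b'
... | yes b≤b' = unresolved-upward N-even 3≤N v₁ v₂ r₁≢r₂ r₁◁r₂ b≤b'
... | no b≰b' = unresolved-transport ρ v₁ v₂
      (unresolved-upward N-even 3≤N (vertex-act ρ v₁) (vertex-act ρ v₂) (r₁≢r₂ ∘ act-injective ρ v₁ v₂)
        (◁-reflect (Vertex.y≤N v₁) (Vertex.y≤N v₂) r₁◁r₂) (∸-monoʳ-≤ N (<⇒≤ (≰⇒> b≰b'))))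
  where
  ρ = reflect N-even

unresolved-horizontal : ∀ {N x y p q} → parity N ≡ 0ℙ → 3 ≤ N → Vertex N (x , y) → Vertex N (p , q) →
                        (x , y) ≢ (p , q) → ∣ y - q ∣ ≤ ∣ x - p ∣ → Unresolved N (x , y) (p , q)
unresolved-horizontal {x = x} {y} {p} {q} N-even 3≤N v₁ v₂ r₁≢r₂ dom with ≤-total x p
... | inj₁ x≤p = unresolved-rightward N-even 3≤N v₁ v₂ r₁≢r₂ (dominant⇒◁ x≤p dom)
... | inj₂ p≤x = unresolved-swap (unresolved-rightward N-even 3≤N v₂ v₁ (r₁≢r₂ ∘ sym)
                   (dominant⇒◁ p≤x (subst₂ _≤_ (∣-∣-comm y q) (∣-∣-comm x p) dom)))

distinct⇒unresolved : ∀ {N r₁ r₂} → parity N ≡ 0ℙ → 3 ≤ N → Vertex N r₁ → Vertex N r₂ → r₁ ≢ r₂ →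
                      Unresolved N r₁ r₂
distinct⇒unresolved {r₁ = x , y} {p , q} N-even 3≤N v₁ v₂ r₁≢r₂ with ≤-total ∣ y - q ∣ ∣ x - p ∣
... | inj₁ dom = unresolved-horizontal N-even 3≤N v₁ v₂ r₁≢r₂ dom
... | inj₂ dom = unresolved-transport transpose v₁ v₂
      (unresolved-horizontal N-even 3≤N (vertex-act transpose v₁) (vertex-act transpose v₂)
        (r₁≢r₂ ∘ act-injective transpose v₁ v₂) dom)

unresolved⇒¬resolving : ∀ {n r₁ r₂ R} → Vertex (2 * n) r₁ → Vertex (2 * n) r₂ → R ⊆ r₁ ∷ r₂ ∷ [] →
                        Unresolved (2 * n) r₁ r₂ → ¬ Resolving n n R
unresolved⇒¬resolving {n} {r₁} {r₂} v₁ v₂ R⊆ (unresolved s t vs vt s≢t e₁ e₂) resolving =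
  s≢t (resolving s t (Vertex⇒IsV vs) (Vertex⇒IsV vt) (λ _ r∈R → same-distance (R⊆ r∈R)))
  where
  same-distance : ∀ {r} → r ∈ r₁ ∷ r₂ ∷ [] → ∃ λ d → Dist n n s r d × Dist n n t r d
  same-distance (here refl) =
    cheb s r₁ , cheb-is-distance vs v₁ , subst (Dist n n t r₁) (sym e₁) (cheb-is-distance vt v₁)
  same-distance (there (here refl)) =
    cheb s r₂ , cheb-is-distance vs v₂ , subst (Dist n n t r₂) (sym e₂) (cheb-is-distance vt v₂)

⊆-distinct-pair : ∀ {N R} → 0 < N → All (Vertex N) R → Unique R → length R ≤ 2 →
                  ∃₂ λ r₁ r₂ → Vertex N r₁ × Vertex N r₂ × r₁ ≢ r₂ × R ⊆ r₁ ∷ r₂ ∷ []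
⊆-distinct-pair 0<N [] _ _ =
  (0 , 1) , (1 , 0) , vertex z≤n 0<N (λ ()) , vertex 0<N z≤n (λ ()) , (λ ()) , λ ()
⊆-distinct-pair {R = r ∷ []} 0<N (v ∷ []) _ _ with ≡-dec _≟_ _≟_ r (0 , 1)
... | yes refl = r , (1 , 0) , v , vertex 0<N z≤n (λ ()) , (λ ()) , λ { (here refl) → here refl }
... | no r≢01  = r , (0 , 1) , v , vertex z≤n 0<N (λ ()) , r≢01 , λ { (here refl) → here refl }
⊆-distinct-pair {R = r₁ ∷ r₂ ∷ []} _ (v₁ ∷ v₂ ∷ []) ((r₁≢r₂ ∷ []) ∷ _) _ =
  r₁ , r₂ , v₁ , v₂ , r₁≢r₂ , λ r∈R → r∈R
⊆-distinct-pair {R = _ ∷ _ ∷ _ ∷ _} _ _ _ (s≤s (s≤s ()))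

lemma2 : (n : ℕ) → 2 ≤ n →
    (R : List Point) → All (IsV n n) R → Unique R → Resolving n n R →
    2 < length R
lemma2 n 2≤n R allV unique resolving = ≰⇒> λ |R|≤2 →
  let r₁ , r₂ , v₁ , v₂ , r₁≢r₂ , R⊆r₁r₂ =
        ⊆-distinct-pair (≤-trans (s≤s z≤n) 3≤N) (All.map IsV⇒Vertex allV) unique |R|≤2
  in unresolved⇒¬resolving v₁ v₂ R⊆r₁r₂
       (distinct⇒unresolved (parity[2*n]≡0ℙ n) 3≤N v₁ v₂ r₁≢r₂) resolving
  where
  3≤N : 3 ≤ 2 * n
  3≤N = ≤-trans (n≤1+n 3) (*-monoʳ-≤ 2 2≤n)
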